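{- Let $\Sigma$ be an alphabet of size $\sigma \ge 2$, $d$ a positive integer, and $T$ a string of length $n > d$ over $\Sigma$. Then $\mathcal{S}(T,d) \in O(d(n-d))$, and this upper bound is tight when $\sigma \ge d+1$: in that case, for every $n > d$ there exists a string $T'$ of length $n$ over $\Sigma$ with $\mathcal{S}(T',d) \in \Omega(d(n-d))$.
   Context: For a string $W$, $W[a..b]$ denotes the substring from position $a$ to position $b$. A string $w$ is present in $W$ if it occurs in $W$ (the empty string is always present) and absent otherwise. A string $w\in\Sigma^\ast$ is a minimal absent word (MAW) of $W$ if $w$ is absent from $W$ and every proper substring of $w$ is present in $W$; $\mathsf{MAW}(W)$ is the set of all MAWs of $W$. For a string $T$ of length $n>d$, $\mathcal{S}(T,d) = \sum_{i=1}^{n-d} |\mathsf{MAW}(T[i..i+d-1]) \bigtriangleup \mathsf{MAW}(T[i+1..i+d])|$, with $\bigtriangleup$ symmetric difference. -}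

module Defs where

open import Data.Nat using (ℕ; suc; _<_; _∸_)
open import Data.List using (List; _++_; length; take; drop; map; upTo)
open import Data.Nat.ListAction using (sum)
open import Data.List.Membership.Propositional using (_∈_)
open import Data.List.Relation.Unary.Unique.Propositional using (Unique)
open import Data.Product using (Σ; _×_; ∃)
open import Data.Sum using (_⊎_)
open import Relation.Nullary using (¬_)
open import Relation.Binary.PropositionalEquality using (_≡_)
open import Function.Bundles using (_⇔_)

Present : {A : Set} → List A → List A → Set
Present W w = ∃ λ u → ∃ λ v → u ++ w ++ v ≡ W

Absent : {A : Set} → List A → List A → Set
Absent W w = ¬ Present W w

ProperSubstring : {A : Set} → List A → List A → Set
ProperSubstring w w' = Present w w' × length w' < length w

MAW : {A : Set} → List A → List A → Set
MAW W w = Absent W w × (∀ w' → ProperSubstring w w' → Present W w')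

SymDiffMAW : {A : Set} → List A → List A → List A → Set
SymDiffMAW W W' w = (MAW W w × ¬ MAW W' w) ⊎ (¬ MAW W w × MAW W' w)

HasCard : {A : Set} → (A → Set) → ℕ → Set
HasCard {A} P k = Σ (List A) λ xs → Unique xs × (∀ x → (x ∈ xs) ⇔ P x) × length xs ≡ k

-- Window T[i+1 .. i+d] (1-based), written 0-based: starting at index i, length d.
window : {A : Set} → List A → ℕ → ℕ → List A
window T d i = take d (drop i T)

-- S T d s : s = 𝒮(T,d) = Σ_{i=1}^{n-d} |MAW(T[i..i+d-1]) △ MAW(T[i+1..i+d])|,
-- with the summation index shifted to i = 0 .. n-d-1.
SValue : {A : Set} → List A → ℕ → ℕ → Set
SValue T d s = Σ (ℕ → ℕ) λ k →
  (∀ i → i < length T ∸ d →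
     HasCard (SymDiffMAW (window T d i) (window T d (suc i))) (k i))
  × s ≡ sum (map k (upTo (length T ∸ d)))

module Submission where

-- Let w = x ∷ r = m ∷ʳ z be a minimal absent word of X = a ∷ V that is not one of Y = V ∷ʳ b.
-- Either w occurs in Y, hence is a suffix of Y; or r is absent from Y, hence a prefix of X, and r is
-- the shortest prefix of X that is not a prefix of s, for x ∷ s the suffix of X at an occurrence of m;
-- or m is absent from Y, hence m = a ∷ p is a prefix of X, and r is the shortest prefix of s that is
-- not a prefix of V, for s the suffix of X at an occurrence of r. So w is determined by a suffix of X
-- or of Y: at most 3(d + 1) minimal absent words are lost per step and, reading all strings
-- backwards, at most as many are gained, whence 𝒮(T, d) ≤ 12 d (n − d).
-- Conversely, if the letters of a ∷ V ∷ʳ b are distinct, then [b] and the words [v, a] for v ∈ a ∷ V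
-- are d + 1 minimal absent words of X but not of Y, which misses a. Every window of the periodic
-- string (c₀ c₁ … c_d)^ω is of this form, so there 𝒮(T, d) ≥ d (n − d).

open import Defs
open import Data.Nat using (ℕ; zero; suc; _≤_; _<_; _*_; _∸_; _+_; _⊓_; z≤n; s≤s)
open import Data.Nat.Properties
open import Data.Nat.ListAction using (sum)
open import Data.Fin as Fin using (Fin; fromℕ<)
open import Data.Fin.Properties using (toℕ-fromℕ<)
open import Data.List
  using (List; []; _∷_; [_]; _++_; _∷ʳ_; length; map; filter; deduplicate; reverse; take; drop; tails; upTo;
         tabulate; lookup; initLast; _∷ʳ′_)
open import Data.List.Properties
open import Data.List.Membership.Propositional using (_∈_; _∉_)
open import Data.List.Membership.Propositional.Properties
open import Data.List.Relation.Binary.Subset.Propositional using (_⊆_)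
open import Data.List.Relation.Unary.All as All using (All; []; _∷_)
open import Data.List.Relation.Unary.All.Properties using (++⁻ˡ; ++⁻ʳ; map⁺)
open import Data.List.Relation.Unary.AllPairs as AllPairs using ([]; _∷_)
open import Data.List.Relation.Unary.Any using (here; there)
import Data.List.Relation.Unary.Any as Any
open import Data.List.Relation.Unary.Unique.Propositional using (Unique)
import Data.List.Relation.Unary.Unique.Propositional.Properties as Unique
open import Data.List.Relation.Unary.Unique.DecPropositional.Properties using (deduplicate-!)
open import Data.Product using (Σ; _×_; ∃; _,_; proj₁; proj₂; map₂)
open import Data.Sum using (_⊎_; inj₁; inj₂; [_,_]′)
open import Data.Empty using (⊥-elim)
open import Function.Bundles using (_⇔_; mk⇔; Equivalence)
open import Relation.Binary.Definitions using (DecidableEquality)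
open import Relation.Binary.PropositionalEquality hiding ([_])
open import Relation.Nullary using (¬_; Dec; yes; no)
open import Relation.Nullary.Decidable using (map′; ¬?; _×-dec_; _⊎-dec_)
open import Relation.Unary using (Decidable)

sum-map≤length* : {B : Set} (f : B → ℕ) {c : ℕ} (xs : List B) →
                  (∀ {x} → x ∈ xs → f x ≤ c) → sum (map f xs) ≤ length xs * c
sum-map≤length* f [] _ = z≤n
sum-map≤length* f (x ∷ xs) f≤c =
  +-mono-≤ (f≤c (here refl)) (sum-map≤length* f xs (λ x∈xs → f≤c (there x∈xs)))

length*≤sum-map : {B : Set} (f : B → ℕ) {c : ℕ} (xs : List B) →
                  (∀ {x} → x ∈ xs → c ≤ f x) → length xs * c ≤ sum (map f xs)
length*≤sum-map f [] _ = z≤n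
length*≤sum-map f (x ∷ xs) c≤f =
  +-mono-≤ (c≤f (here refl)) (length*≤sum-map f xs (λ x∈xs → c≤f (there x∈xs)))

<∸-comm : {i k n : ℕ} → i < n ∸ k → k < n ∸ i
<∸-comm {i} {k} {n} i<n∸k =
  m+n≤o⇒m≤o∸n (suc k) (subst (_≤ n) (cong suc (+-comm i k)) (m≤o∸n⇒m+n≤o (suc i) k≤n i<n∸k))
  where
  k≤n : k ≤ n
  k≤n = <⇒≤ (m∸n≢0⇒n<m (λ n∸k≡0 → n≮0 (subst (i <_) n∸k≡0 i<n∸k)))

6*[1+n]≤12*n : {n : ℕ} → 1 ≤ n → 6 * suc n ≤ 12 * n
6*[1+n]≤12*n {n} 1≤n = begin
    6 * suc n      ≡⟨ *-suc 6 n ⟩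
    6 + 6 * n      ≤⟨ +-monoˡ-≤ (6 * n) (*-monoʳ-≤ 6 1≤n) ⟩
    6 * n + 6 * n  ≡⟨ sym (*-distribʳ-+ n 6 6) ⟩
    12 * n         ∎
  where open ≤-Reasoning

module _ {B : Set} (_≟_ : DecidableEquality B) where

  Unique-⊆⇒length≤ : {xs ys : List B} → Unique xs → xs ⊆ ys → length xs ≤ length ys
  Unique-⊆⇒length≤ {[]} _ _ = z≤n
  Unique-⊆⇒length≤ {x ∷ xs} {ys} (x≢xs ∷ xs!) xs⊆ys = begin-strict
      length xs                ≤⟨ Unique-⊆⇒length≤ xs! xs⊆ys∖x ⟩
      length (filter ≢x? ys)   <⟨ filter-notAll ≢x? ys (Any.map (λ x≡y y≢x → y≢x (sym x≡y)) x∈ys) ⟩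
      length ys                ∎
    where
    open ≤-Reasoning
    ≢x? : Decidable (_≢ x)
    ≢x? y = ¬? (y ≟ x)
    x∈ys : x ∈ ys
    x∈ys = xs⊆ys (here refl)
    xs⊆ys∖x : xs ⊆ filter ≢x? ys
    xs⊆ys∖x y∈xs = ∈-filter⁺ ≢x? (xs⊆ys (there y∈xs)) (λ y≡x → All.lookup x≢xs y∈xs (sym y≡x))

  Unique⇒length≤card : {P : B → Set} {k : ℕ} {ys : List B} →
                       HasCard P k → Unique ys → All P ys → length ys ≤ k
  Unique⇒length≤card (xs , _ , xs⇔P , refl) ys! Pys =
    Unique-⊆⇒length≤ ys! (λ y∈ys → Equivalence.from (xs⇔P _) (All.lookup Pys y∈ys))

  module _ {P : B → Set} (P? : Decidable P) where

    enumerate : List B → List B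
    enumerate C = deduplicate _≟_ (filter P? C)

    enumerate-HasCard : (C : List B) → (∀ {x} → P x → x ∈ C) → HasCard P (length (enumerate C))
    enumerate-HasCard C P⊆C = enumerate C , deduplicate-! _≟_ (filter P? C) , (λ x → mk⇔ to from) , refl
      where
      to : ∀ {x} → x ∈ enumerate C → P x
      to x∈ = proj₂ (∈-filter⁻ P? {xs = C} (∈-deduplicate⁻ _≟_ (filter P? C) x∈))
      from : ∀ {x} → P x → x ∈ enumerate C
      from Px = ∈-deduplicate⁺ _≟_ (∈-filter⁺ P? (P⊆C Px) Px)

    length-enumerate≤ : (C : List B) → length (enumerate C) ≤ length C
    length-enumerate≤ C = ≤-trans (length-deduplicate _≟_ (filter P? C)) (length-filter P? C)

module _ {A : Set} where

  Present-[] : (W : List A) → Present W []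
  Present-[] W = [] , W , refl

  Present-trans : {W w w′ : List A} → Present W w → Present w w′ → Present W w′
  Present-trans {W} {w} {w′} (u , v , uwv≡W) (u′ , v′ , u′w′v′≡w) = u ++ u′ , v′ ++ v , (begin
      (u ++ u′) ++ w′ ++ v′ ++ v   ≡⟨ ++-assoc u u′ _ ⟩
      u ++ u′ ++ w′ ++ v′ ++ v     ≡⟨ cong (λ q → u ++ u′ ++ q) (sym (++-assoc w′ v′ v)) ⟩
      u ++ u′ ++ (w′ ++ v′) ++ v   ≡⟨ cong (u ++_) (sym (++-assoc u′ (w′ ++ v′) v)) ⟩
      u ++ (u′ ++ w′ ++ v′) ++ v   ≡⟨ cong (λ q → u ++ q ++ v) u′w′v′≡w ⟩
      u ++ w ++ v                  ≡⟨ uwv≡W ⟩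
      W                            ∎)
    where open ≡-Reasoning

  Present-tail : (x : A) (V : List A) → Present (x ∷ V) V
  Present-tail x V = [ x ] , [] , cong (x ∷_) (++-identityʳ V)

  Present-init : (V : List A) (x : A) → Present (V ∷ʳ x) V
  Present-init V x = [] , [ x ] , refl

  Absent-substring : {W V w : List A} → Present W V → Absent W w → Absent V w
  Absent-substring V∈W w∉W w∈V = w∉W (Present-trans V∈W w∈V)

  ∈⇒Present : {x : A} {W : List A} → x ∈ W → Present W [ x ]
  ∈⇒Present x∈W with u , v , W≡uxv ← ∈-∃++ x∈W = u , v , sym W≡uxv

  Present⇒∈ : {x : A} {W : List A} → Present W [ x ] → x ∈ W
  Present⇒∈ (u , v , refl) = ∈-insert u

  ∷≡∷ʳ : (x : A) (r : List A) → ∃ λ m → ∃ λ z → x ∷ r ≡ m ∷ʳ z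
  ∷≡∷ʳ x [] = [] , x , refl
  ∷≡∷ʳ x (y ∷ r) with m , z , yr≡mz ← ∷≡∷ʳ y r = x ∷ m , z , cong (x ∷_) yr≡mz

  length-∷ʳ : (V : List A) (x : A) → length (V ∷ʳ x) ≡ suc (length V)
  length-∷ʳ V x = trans (length-++ V) (+-comm (length V) 1)

  ProperSubstring-tail : (x : A) (r : List A) → ProperSubstring (x ∷ r) r
  ProperSubstring-tail x r = Present-tail x r , ≤-refl

  ProperSubstring-init : (m : List A) (z : A) → ProperSubstring (m ∷ʳ z) m
  ProperSubstring-init m z = Present-init m z , ≤-reflexive (sym (length-∷ʳ m z))

  ProperSubstring⇒tail⊎init : {x z : A} {r m w′ : List A} → x ∷ r ≡ m ∷ʳ z →
                              ProperSubstring (x ∷ r) w′ → Present r w′ ⊎ Present m w′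
  ProperSubstring⇒tail⊎init _ ((_ ∷ u , v , e) , _) = inj₁ (u , v , ∷-injectiveʳ e)
  ProperSubstring⇒tail⊎init {w′ = w′} _ (([] , [] , e) , w′<) =
    ⊥-elim (<-irrefl (cong length (trans (sym (++-identityʳ w′)) e)) w′<)
  ProperSubstring⇒tail⊎init {x} {z} {r} {m} {w′} xr≡mz (([] , y ∷ v , e) , _)
    with v′ , z′ , yv≡v′z′ ← ∷≡∷ʳ y v =
    inj₂ ([] , v′ , proj₁ (∷ʳ-injective (w′ ++ v′) m (begin
      (w′ ++ v′) ∷ʳ z′   ≡⟨ ++-assoc w′ v′ [ z′ ] ⟩
      w′ ++ v′ ∷ʳ z′     ≡⟨ cong (w′ ++_) (sym yv≡v′z′) ⟩
      w′ ++ y ∷ v        ≡⟨ e ⟩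
      x ∷ r              ≡⟨ xr≡mz ⟩
      m ∷ʳ z             ∎)))
    where open ≡-Reasoning

  MAW-tail : {W : List A} {x : A} {r : List A} → MAW W (x ∷ r) → Present W r
  MAW-tail {x = x} {r} (_ , sub) = sub r (ProperSubstring-tail x r)

  MAW-init : {W m : List A} {z : A} → MAW W (m ∷ʳ z) → Present W m
  MAW-init {m = m} {z} (_ , sub) = sub m (ProperSubstring-init m z)

  MAW⇔ : {W : List A} {x z : A} {r m : List A} → x ∷ r ≡ m ∷ʳ z →
         MAW W (x ∷ r) ⇔ (Absent W (x ∷ r) × Present W r × Present W m)
  MAW⇔ xr≡mz = mk⇔
    (λ maw → proj₁ maw , MAW-tail maw , MAW-init (subst (MAW _) xr≡mz maw))
    (λ (absent , r∈W , m∈W) → absent , λ w′ w′⊂ →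
      [ Present-trans r∈W , Present-trans m∈W ]′ (ProperSubstring⇒tail⊎init xr≡mz w′⊂))

  Present-reverse : {W w : List A} → Present W w → Present (reverse W) (reverse w)
  Present-reverse {W} {w} (u , v , uwv≡W) = reverse v , reverse u , (begin
      reverse v ++ reverse w ++ reverse u     ≡⟨ sym (++-assoc (reverse v) _ _) ⟩
      (reverse v ++ reverse w) ++ reverse u   ≡⟨ cong (_++ reverse u) (sym (reverse-++ w v)) ⟩
      reverse (w ++ v) ++ reverse u           ≡⟨ sym (reverse-++ u (w ++ v)) ⟩
      reverse (u ++ w ++ v)                   ≡⟨ cong reverse uwv≡W ⟩
      reverse W                               ∎)
    where open ≡-Reasoning

  Present-reverseˡ : {W w : List A} → Present (reverse W) w → Present W (reverse w)
  Present-reverseˡ {W} p = subst (λ V → Present V _) (reverse-involutive W) (Present-reverse p)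

  MAW-reverse : {W w : List A} → MAW W w → MAW (reverse W) (reverse w)
  MAW-reverse {W} {w} (absent , sub) =
      (λ p → absent (subst (Present W) (reverse-involutive w) (Present-reverseˡ p)))
    , λ w′ (p , w′<) → subst (Present (reverse W)) (reverse-involutive w′) (Present-reverse
        (sub (reverse w′) (Present-reverseˡ p , subst₂ _<_ (sym (length-reverse w′)) (length-reverse w) w′<)))

  MAW-reverse⁻ : {W w : List A} → MAW (reverse W) (reverse w) → MAW W w
  MAW-reverse⁻ {W} {w} maw = subst₂ MAW (reverse-involutive W) (reverse-involutive w) (MAW-reverse maw)

  ∈-tails : (u s : List A) → s ∈ tails (u ++ s)
  ∈-tails [] s = here refl
  ∈-tails (y ∷ u) s = there (∈-tails u s)

  length-tails : (L : List A) → length (tails L) ≡ suc (length L)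
  length-tails [] = refl
  length-tails (x ∷ L) = cong suc (length-tails L)

  Present-∷ʳ⇒suffix : {V w : List A} {b : A} → Present (V ∷ʳ b) w → Absent V w → w ∈ tails (V ∷ʳ b)
  Present-∷ʳ⇒suffix {w = w} (u , [] , e) _ =
    subst (λ L → w ∈ tails L) (trans (cong (u ++_) (sym (++-identityʳ w))) e) (∈-tails u w)
  Present-∷ʳ⇒suffix {V} {w} {b} (u , y ∷ v , e) w∉V with v′ , z , yv≡v′z ← ∷≡∷ʳ y v =
    ⊥-elim (w∉V (u , v′ , proj₁ (∷ʳ-injective (u ++ w ++ v′) V (begin
      (u ++ w ++ v′) ∷ʳ z   ≡⟨ ++-assoc u (w ++ v′) [ z ] ⟩
      u ++ (w ++ v′) ∷ʳ z   ≡⟨ cong (u ++_) (++-assoc w v′ [ z ]) ⟩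
      u ++ w ++ v′ ∷ʳ z     ≡⟨ cong (λ q → u ++ w ++ q) (sym yv≡v′z) ⟩
      u ++ w ++ y ∷ v       ≡⟨ e ⟩
      V ∷ʳ b                ∎))))
    where open ≡-Reasoning

  Present-∷⇒prefix : {a : A} {V w : List A} → Present (a ∷ V) w → Absent V w → ∃ λ t → w ++ t ≡ a ∷ V
  Present-∷⇒prefix ([] , t , e) _ = t , e
  Present-∷⇒prefix (_ ∷ u , v , e) w∉V = ⊥-elim (w∉V (u , v , ∷-injectiveʳ e))

  Absent-[v,a] : {a v : A} {V : List A} → a ∉ V → Absent (a ∷ V) (v ∷ [ a ])
  Absent-[v,a] a∉V ([] , w , e) = a∉V (Present⇒∈ ([] , w , ∷-injectiveʳ e))
  Absent-[v,a] {a} {v} a∉V (_ ∷ u , w , e) =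
    a∉V (Present⇒∈ (Present-trans (u , w , ∷-injectiveʳ e) (Present-tail v [ a ])))

  Unique-∷ʳ⁻ : {V : List A} {b : A} → Unique (V ∷ʳ b) → Unique V × b ∉ V
  Unique-∷ʳ⁻ {[]} _ = [] , λ ()
  Unique-∷ʳ⁻ {v ∷ V} (v≢Vb ∷ Vb!) with V! , b∉V ← Unique-∷ʳ⁻ Vb! = ++⁻ˡ V v≢Vb ∷ V! , b∉vV
    where
    b∉vV : _ ∉ v ∷ V
    b∉vV (here b≡v) = All.lookup (++⁻ʳ V v≢Vb) (here refl) (sym b≡v)
    b∉vV (there b∈V) = b∉V b∈V

  Unique-rotate : {x : A} {L : List A} → Unique (x ∷ L) → Unique (L ∷ʳ x)
  Unique-rotate (x≢L ∷ L!) = Unique.++⁺ L! ([] ∷ []) λ { (x∈L , here refl) → All.lookup x≢L x∈L refl }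

  -- The first n letters of (x ∷ S)^ω, obtained by rotating the period rather than indexing modulo its length.
  periodic : A → List A → ℕ → List A
  periodic x S zero = []
  periodic x [] (suc n) = x ∷ periodic x [] n
  periodic x (y ∷ S) (suc n) = x ∷ periodic y (S ∷ʳ x) n

  length-periodic : (x : A) (S : List A) (n : ℕ) → length (periodic x S n) ≡ n
  length-periodic x S zero = refl
  length-periodic x [] (suc n) = cong suc (length-periodic x [] n)
  length-periodic x (y ∷ S) (suc n) = cong suc (length-periodic y (S ∷ʳ x) n)

  take-++ˡ : (k : ℕ) (L R : List A) → k ≤ length L → take k (L ++ R) ≡ take k L
  take-++ˡ zero L R _ = refl
  take-++ˡ (suc k) (x ∷ L) R (s≤s k≤L) = cong (x ∷_) (take-++ˡ k L R k≤L)

  take-periodic : (k : ℕ) (x : A) (S : List A) (m : ℕ) → k ≤ length S → k ≤ m →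
                  take (suc k) (periodic x S (suc m)) ≡ x ∷ take k S
  take-periodic zero x [] m _ _ = refl
  take-periodic zero x (y ∷ S) m _ _ = refl
  take-periodic (suc k) x (y ∷ S) (suc m) (s≤s k≤S) (s≤s k≤m) = cong (x ∷_) (begin
      take (suc k) (periodic y (S ∷ʳ x) (suc m))   ≡⟨ take-periodic k y (S ∷ʳ x) m k≤S∷ʳx k≤m ⟩
      y ∷ take k (S ∷ʳ x)                          ≡⟨ cong (y ∷_) (take-++ˡ k S [ x ] k≤S) ⟩
      y ∷ take k S                                 ∎)
    where
    open ≡-Reasoning
    k≤S∷ʳx : k ≤ length (S ∷ʳ x)
    k≤S∷ʳx = ≤-trans (m≤n⇒m≤1+n k≤S) (≤-reflexive (sym (length-∷ʳ S x)))

  Unique-window-periodic : (i : ℕ) (x : A) (S : List A) (n : ℕ) → Unique (x ∷ S) → length S < n ∸ i →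
                           Unique (take (suc (length S)) (drop i (periodic x S n)))
  Unique-window-periodic zero x S zero _ ()
  Unique-window-periodic zero x S (suc m) xS! (s≤s S≤m) = subst Unique (sym (begin
      take (suc (length S)) (periodic x S (suc m))   ≡⟨ take-periodic (length S) x S m ≤-refl S≤m ⟩
      x ∷ take (length S) S                          ≡⟨ cong (x ∷_) (take-all (length S) S ≤-refl) ⟩
      x ∷ S                                          ∎)) xS!
    where open ≡-Reasoning
  Unique-window-periodic (suc i) x S zero _ ()
  Unique-window-periodic (suc i) x [] (suc m) x! S<m∸i = Unique-window-periodic i x [] m x! S<m∸i
  Unique-window-periodic (suc i) x (y ∷ S) (suc m) xyS! yS<m∸i =
    subst (λ k → Unique (take (suc k) (drop i (periodic y (S ∷ʳ x) m)))) (length-∷ʳ S x)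
      (Unique-window-periodic i y (S ∷ʳ x) m (Unique-rotate xyS!)
        (subst (_< m ∸ i) (sym (length-∷ʳ S x)) yS<m∸i))

  take-suc-∷ʳ : {k : ℕ} (L : List A) → k < length L → ∃ λ b → take (suc k) L ≡ take k L ∷ʳ b
  take-suc-∷ʳ L k<L =
    lookup L i , subst (λ k → take (suc k) L ≡ take k L ∷ʳ lookup L i) (toℕ-fromℕ< k<L) (take-suc L i)
    where i = fromℕ< k<L

  drop-suc : (i : ℕ) (T : List A) → drop (suc i) T ≡ drop 1 (drop i T)
  drop-suc zero T = refl
  drop-suc (suc i) [] = refl
  drop-suc (suc i) (x ∷ T) = drop-suc i T

  take-slide : (d : ℕ) (L : List A) → suc d < length L →
               ∃ λ a → ∃ λ V → ∃ λ b → take (suc d) L ≡ a ∷ V × take (suc d) (drop 1 L) ≡ V ∷ʳ b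
                 × take (suc (suc d)) L ≡ a ∷ V ++ [ b ] × length V ≡ d
  take-slide d (a ∷ L) (s≤s d<L) with b , L≡ ← take-suc-∷ʳ L d<L =
    a , take d L , b , refl , L≡ , cong (a ∷_) L≡ , trans (length-take d L) (m≤n⇒m⊓n≡m (<⇒≤ d<L))

  window-slide : (T : List A) (d i : ℕ) → i < length T ∸ suc d →
                 ∃ λ a → ∃ λ V → ∃ λ b → window T (suc d) i ≡ a ∷ V
                   × window T (suc d) (suc i) ≡ V ∷ʳ b
                   × take (suc (suc d)) (drop i T) ≡ a ∷ V ++ [ b ] × length V ≡ d
  window-slide T d i i<T∸d
    with a , V , b , X≡ , Y≡ , XY≡ , V≡d ← take-slide d (drop i T)
                                             (subst (suc d <_) (sym (length-drop i T)) (<∸-comm i<T∸d))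
    = a , V , b , X≡ , trans (cong (take (suc d)) (drop-suc i T)) Y≡ , XY≡ , V≡d

  length-window : (T : List A) (d i : ℕ) → length (window T d i) ≤ d
  length-window T d i = ≤-trans (≤-reflexive (length-take d (drop i T))) (m⊓n≤m d _)

module _ {A : Set} (_≟_ : DecidableEquality A) where

  isPrefix? : (w W : List A) → Dec (∃ λ v → w ++ v ≡ W)
  isPrefix? [] W = yes (W , refl)
  isPrefix? (x ∷ w) [] = no λ ()
  isPrefix? (x ∷ w) (c ∷ W) with x ≟ c | isPrefix? w W
  ... | yes refl | yes (v , wv≡W) = yes (v , cong (x ∷_) wv≡W)
  ... | yes refl | no ¬prefix = no λ (v , e) → ¬prefix (v , ∷-injectiveʳ e)
  ... | no x≢c | _ = no λ (v , e) → x≢c (∷-injectiveˡ e)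

  present? : (W w : List A) → Dec (Present W w)
  present? W w with isPrefix? w W
  ... | yes (v , wv≡W) = yes ([] , v , wv≡W)
  present? [] w | no ¬prefix = no λ where
    ([] , v , e) → ¬prefix (v , e)
  present? (c ∷ W) w | no ¬prefix with present? W w
  ... | yes (u , v , e) = yes (c ∷ u , v , cong (c ∷_) e)
  ... | no w∉W = no λ where
    ([] , v , e) → ¬prefix (v , e)
    (_ ∷ u , v , e) → w∉W (u , v , ∷-injectiveʳ e)

  MAW? : (W w : List A) → Dec (MAW W w)
  MAW? W [] = no λ (absent , _) → absent (Present-[] W)
  MAW? W (x ∷ r) with m , z , xr≡mz ← ∷≡∷ʳ x r =
    map′ (Equivalence.from (MAW⇔ xr≡mz)) (Equivalence.to (MAW⇔ xr≡mz))
      (¬? (present? W (x ∷ r)) ×-dec present? W r ×-dec present? W m)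

  SymDiffMAW? : (X Y : List A) → Decidable (SymDiffMAW X Y)
  SymDiffMAW? X Y w = (MAW? X w ×-dec ¬? (MAW? Y w)) ⊎-dec (¬? (MAW? X w) ×-dec MAW? Y w)

  ¬MAW⇒ : {W : List A} {x z : A} {r m : List A} → x ∷ r ≡ m ∷ʳ z → ¬ MAW W (x ∷ r) →
          Present W (x ∷ r) ⊎ Absent W r ⊎ Absent W m
  ¬MAW⇒ {W} {x} {z} {r} {m} xr≡mz ¬maw with present? W (x ∷ r) | present? W r | present? W m
  ... | yes xr∈W | _ | _ = inj₁ xr∈W
  ... | no _ | no r∉W | _ = inj₂ (inj₁ r∉W)
  ... | no _ | yes _ | no m∉W = inj₂ (inj₂ m∉W)
  ... | no xr∉W | yes r∈W | yes m∈W = ⊥-elim (¬maw (Equivalence.from (MAW⇔ xr≡mz) (xr∉W , r∈W , m∈W)))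

  mismatchPrefix : List A → List A → List A
  mismatchPrefix [] r = []
  mismatchPrefix (z ∷ P) [] = [ z ]
  mismatchPrefix (z ∷ P) (y ∷ r) with z ≟ y
  ... | yes _ = z ∷ mismatchPrefix P r
  ... | no _ = [ z ]

  mismatchPrefix-++ : (p : List A) (z : A) (t v : List A) → (∀ v′ → v ≢ z ∷ v′) →
                      mismatchPrefix (p ++ z ∷ t) (p ++ v) ≡ p ++ [ z ]
  mismatchPrefix-++ [] z t [] _ = refl
  mismatchPrefix-++ [] z t (y ∷ v) v≢z∷ with z ≟ y
  ... | yes refl = ⊥-elim (v≢z∷ v refl)
  ... | no _ = refl
  mismatchPrefix-++ (c ∷ p) z t v v≢z∷ with c ≟ c
  ... | yes _ = cong (c ∷_) (mismatchPrefix-++ p z t v v≢z∷)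
  ... | no c≢c = ⊥-elim (c≢c refl)

  extendAt : List A → List A → List A
  extendAt X [] = []
  extendAt X (x ∷ s) = x ∷ mismatchPrefix X s

  headExtensions : List A → List (List A)
  headExtensions [] = []
  headExtensions (a ∷ V) = map (λ s → a ∷ mismatchPrefix s V) (tails (a ∷ V))

  lostCandidates : List A → List A → List (List A)
  lostCandidates X Y = tails Y ++ map (extendAt X) (tails X) ++ headExtensions X

  candidates : List A → List A → List (List A)
  candidates X Y = lostCandidates X Y ++ map reverse (lostCandidates (reverse Y) (reverse X))

  extension∈ : (x : A) (p : List A) (z : A) (t : List A) → MAW (p ++ z ∷ t) (x ∷ p ++ [ z ]) →
               x ∷ p ++ [ z ] ∈ map (extendAt (p ++ z ∷ t)) (tails (p ++ z ∷ t))
  extension∈ x p z t maw with Equivalence.to (MAW⇔ {m = x ∷ p} refl) maw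
  ... | absent , _ , (u , v , uxpv≡X) =
    subst (_∈ map (extendAt X) (tails X)) (cong (x ∷_) (mismatchPrefix-++ p z t v v≢z∷))
      (∈-map⁺ (extendAt X) (subst (λ L → x ∷ p ++ v ∈ tails L) uxpv≡X (∈-tails u (x ∷ p ++ v))))
    where
    X = p ++ z ∷ t
    v≢z∷ : ∀ v′ → v ≢ z ∷ v′
    v≢z∷ v′ v≡ = absent (u , v′ , trans (cong (λ q → u ++ x ∷ q) (++-assoc p [ z ] v′))
                                        (subst (λ q → u ++ x ∷ p ++ q ≡ X) v≡ uxpv≡X))

  headExtension∈ : (a : A) (p : List A) (z : A) (t : List A) → MAW (a ∷ p ++ t) (a ∷ p ++ [ z ]) →
                   a ∷ p ++ [ z ] ∈ headExtensions (a ∷ p ++ t)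
  headExtension∈ a p z t maw with Equivalence.to (MAW⇔ {m = a ∷ p} refl) maw
  ... | absent , (u , v , upzv≡X) , _ =
    subst (_∈ headExtensions (a ∷ p ++ t)) (cong (a ∷_) (mismatchPrefix-++ p z v t t≢z∷))
      (∈-map⁺ _ (subst (λ L → p ++ z ∷ v ∈ tails L)
                       (trans (cong (u ++_) (sym (++-assoc p [ z ] v))) upzv≡X) (∈-tails u (p ++ z ∷ v))))
    where
    t≢z∷ : ∀ t′ → t ≢ z ∷ t′
    t≢z∷ t′ t≡ = absent ([] , t′ , cong (a ∷_) (trans (++-assoc p [ z ] t′) (cong (p ++_) (sym t≡))))

  tailAbsent∈ : {a x : A} {V r : List A} → MAW (a ∷ V) (x ∷ r) → Absent V r →
                x ∷ r ∈ map (extendAt (a ∷ V)) (tails (a ∷ V))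
  tailAbsent∈ {a} {x} {V} {r} maw r∉V with initLast r
  ... | [] = ⊥-elim (r∉V (Present-[] _))
  ... | p ∷ʳ′ z with t , pzt≡X ← Present-∷⇒prefix (MAW-tail maw) r∉V =
    subst (λ X → x ∷ p ++ [ z ] ∈ map (extendAt X) (tails X)) X≡
      (extension∈ x p z t (subst (λ X → MAW X (x ∷ p ++ [ z ])) (sym X≡) maw))
    where
    X≡ : p ++ z ∷ t ≡ a ∷ V
    X≡ = trans (sym (∷ʳ-++ p z t)) pzt≡X

  initAbsent∈ : {a z : A} {V m : List A} → MAW (a ∷ V) (m ∷ʳ z) → Absent V m →
                m ∷ʳ z ∈ headExtensions (a ∷ V)
  initAbsent∈ {m = []} _ m∉V = ⊥-elim (m∉V (Present-[] _))
  initAbsent∈ {z = z} {m = c ∷ p} maw m∉V with Present-∷⇒prefix (MAW-init maw) m∉V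
  ... | t , refl = headExtension∈ c p z t maw

  lost∈lostCandidates : (a : A) (V : List A) (b : A) {w : List A} → MAW (a ∷ V) w → ¬ MAW (V ∷ʳ b) w →
                        w ∈ lostCandidates (a ∷ V) (V ∷ʳ b)
  lost∈lostCandidates a V b {[]} (absent , _) _ = ⊥-elim (absent (Present-[] _))
  lost∈lostCandidates a V b {x ∷ r} maw ¬maw′ with m , z , xr≡mz ← ∷≡∷ʳ x r | ¬MAW⇒ xr≡mz ¬maw′
  ... | inj₁ w∈Y =
    ∈-++⁺ˡ (Present-∷ʳ⇒suffix w∈Y (Absent-substring (Present-tail a V) (proj₁ maw)))
  ... | inj₂ (inj₁ r∉Y) = ∈-++⁺ʳ (tails (V ∷ʳ b)) (∈-++⁺ˡ
    (tailAbsent∈ maw (Absent-substring (Present-init V b) r∉Y)))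
  ... | inj₂ (inj₂ m∉Y) = ∈-++⁺ʳ (tails (V ∷ʳ b)) (∈-++⁺ʳ (map (extendAt (a ∷ V)) (tails (a ∷ V)))
    (subst (_∈ headExtensions (a ∷ V)) (sym xr≡mz)
      (initAbsent∈ (subst (MAW (a ∷ V)) xr≡mz maw) (Absent-substring (Present-init V b) m∉Y))))

  gained∈ : (a : A) (V : List A) (b : A) {w : List A} → MAW (V ∷ʳ b) w → ¬ MAW (a ∷ V) w →
            w ∈ map reverse (lostCandidates (reverse (V ∷ʳ b)) (reverse (a ∷ V)))
  gained∈ a V b {w} maw ¬maw′ =
    subst (_∈ map reverse (lostCandidates (reverse (V ∷ʳ b)) (reverse (a ∷ V)))) (reverse-involutive w)
      (∈-map⁺ reverse (subst₂ (λ X Y → reverse w ∈ lostCandidates X Y) (sym reverse-Y) (sym (unfold-reverse a V))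
        (lost∈lostCandidates b (reverse V) a
          (subst (λ X → MAW X (reverse w)) reverse-Y (MAW-reverse maw))
          (λ maw′ → ¬maw′ (MAW-reverse⁻ (subst (λ X → MAW X (reverse w)) (sym (unfold-reverse a V)) maw′))))))
    where
    reverse-Y : reverse (V ∷ʳ b) ≡ b ∷ reverse V
    reverse-Y = reverse-++ V [ b ]

  SymDiffMAW⊆candidates : (a : A) (V : List A) (b : A) {w : List A} →
                          SymDiffMAW (a ∷ V) (V ∷ʳ b) w → w ∈ candidates (a ∷ V) (V ∷ʳ b)
  SymDiffMAW⊆candidates a V b (inj₁ (maw , ¬maw′)) = ∈-++⁺ˡ (lost∈lostCandidates a V b maw ¬maw′)
  SymDiffMAW⊆candidates a V b (inj₂ (¬maw , maw′)) =
    ∈-++⁺ʳ (lostCandidates (a ∷ V) (V ∷ʳ b)) (gained∈ a V b maw′ ¬maw)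

  length-headExtensions : (X : List A) → length (headExtensions X) ≤ suc (length X)
  length-headExtensions [] = z≤n
  length-headExtensions (a ∷ V) =
    ≤-reflexive (trans (length-map (λ s → a ∷ mismatchPrefix s V) (tails (a ∷ V))) (length-tails (a ∷ V)))

  length-lostCandidates : {d : ℕ} (X Y : List A) → length X ≤ d → length Y ≤ d →
                          length (lostCandidates X Y) ≤ 3 * suc d
  length-lostCandidates {d} X Y X≤d Y≤d = begin
      length (tails Y ++ map (extendAt X) (tails X) ++ headExtensions X)
        ≡⟨ length-++ (tails Y) ⟩
      length (tails Y) + length (map (extendAt X) (tails X) ++ headExtensions X)
        ≡⟨ cong (length (tails Y) +_) (length-++ (map (extendAt X) (tails X))) ⟩
      length (tails Y) + (length (map (extendAt X) (tails X)) + length (headExtensions X))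
        ≡⟨ cong₂ (λ p q → p + (q + length (headExtensions X)))
                 (length-tails Y) (trans (length-map _ (tails X)) (length-tails X)) ⟩
      suc (length Y) + (suc (length X) + length (headExtensions X))
        ≤⟨ +-mono-≤ (s≤s Y≤d) (+-mono-≤ (s≤s X≤d) (≤-trans (length-headExtensions X) (s≤s X≤d))) ⟩
      suc d + (suc d + suc d)
        ≡⟨ cong (λ q → suc d + (suc d + q)) (sym (+-identityʳ (suc d))) ⟩
      3 * suc d ∎
    where open ≤-Reasoning

  length-candidates : {d : ℕ} (X Y : List A) → length X ≤ d → length Y ≤ d →
                      length (candidates X Y) ≤ 6 * suc d
  length-candidates {d} X Y X≤d Y≤d = begin
      length (lostCandidates X Y ++ map reverse (lostCandidates (reverse Y) (reverse X)))
        ≡⟨ length-++ (lostCandidates X Y) ⟩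
      length (lostCandidates X Y) + length (map reverse (lostCandidates (reverse Y) (reverse X)))
        ≡⟨ cong (length (lostCandidates X Y) +_) (length-map reverse (lostCandidates (reverse Y) (reverse X))) ⟩
      length (lostCandidates X Y) + length (lostCandidates (reverse Y) (reverse X))
        ≤⟨ +-mono-≤ (length-lostCandidates X Y X≤d Y≤d)
                    (length-lostCandidates (reverse Y) (reverse X) (subst (_≤ d) (sym (length-reverse Y)) Y≤d)
                                                                   (subst (_≤ d) (sym (length-reverse X)) X≤d)) ⟩
      3 * suc d + 3 * suc d
        ≡⟨ sym (*-distribʳ-+ (suc d) 3 3) ⟩
      6 * suc d ∎
    where open ≤-Reasoning

  symDiffCount : List A → List A → ℕ
  symDiffCount X Y = length (enumerate (≡-dec _≟_) (SymDiffMAW? X Y) (candidates X Y))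

  symDiffCount-HasCard : (a : A) (V : List A) (b : A) →
                         HasCard (SymDiffMAW (a ∷ V) (V ∷ʳ b)) (symDiffCount (a ∷ V) (V ∷ʳ b))
  symDiffCount-HasCard a V b = enumerate-HasCard (≡-dec _≟_) (SymDiffMAW? _ _) _ (SymDiffMAW⊆candidates a V b)

  symDiffCount≤ : {d : ℕ} (X Y : List A) → length X ≤ d → length Y ≤ d → symDiffCount X Y ≤ 6 * suc d
  symDiffCount≤ X Y X≤d Y≤d =
    ≤-trans (length-enumerate≤ (≡-dec _≟_) (SymDiffMAW? X Y) (candidates X Y)) (length-candidates X Y X≤d Y≤d)

  symDiffCount-distinct : (a : A) (V : List A) (b : A) → Unique (a ∷ V ++ [ b ]) →
                          suc (length V) ≤ symDiffCount (a ∷ V) (V ∷ʳ b)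
  symDiffCount-distinct a V b aVb! = begin
      suc (length V)   ≤⟨ n≤1+n _ ⟩
      2 + length V     ≡⟨ cong (2 +_) (sym (length-map [_,a] V)) ⟩
      length ws        ≤⟨ Unique⇒length≤card (≡-dec _≟_) (symDiffCount-HasCard a V b) ws! ws-lost ⟩
      symDiffCount (a ∷ V) (V ∷ʳ b) ∎
    where
    open ≤-Reasoning
    [_,a] : A → List A
    [ v ,a] = v ∷ [ a ]
    ws : List (List A)
    ws = [ b ] ∷ map [_,a] (a ∷ V)
    aV! : Unique (a ∷ V)
    aV! = proj₁ (Unique-∷ʳ⁻ {V = a ∷ V} aVb!)
    b∉aV : b ∉ a ∷ V
    b∉aV = proj₂ (Unique-∷ʳ⁻ {V = a ∷ V} aVb!)
    a∉Vb : a ∉ V ∷ʳ b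
    a∉Vb a∈Vb = All.lookup (AllPairs.head aVb!) a∈Vb refl
    ws! : Unique ws
    ws! = map⁺ (All.tabulate (λ _ ())) ∷ Unique.map⁺ ∷-injectiveˡ aV!
    lost-[b] : SymDiffMAW (a ∷ V) (V ∷ʳ b) [ b ]
    lost-[b] = inj₁ ( Equivalence.from (MAW⇔ {r = []} {m = []} refl)
                        ((λ p → b∉aV (Present⇒∈ p)) , Present-[] _ , Present-[] _)
                    , λ maw′ → proj₁ maw′ (∈⇒Present (∈-++⁺ʳ V (here refl))))
    lost-[v,a] : ∀ {v} → v ∈ a ∷ V → SymDiffMAW (a ∷ V) (V ∷ʳ b) [ v ,a]
    lost-[v,a] v∈aV = inj₁ ( Equivalence.from (MAW⇔ {m = [ _ ]} refl)
                               ( Absent-[v,a] (λ a∈V → a∉Vb (∈-++⁺ˡ a∈V))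
                               , ∈⇒Present (here refl) , ∈⇒Present v∈aV)
                           , λ maw′ → a∉Vb (Present⇒∈ (MAW-tail maw′)))
    ws-lost : All (SymDiffMAW (a ∷ V) (V ∷ʳ b)) ws
    ws-lost = lost-[b] ∷ map⁺ (All.tabulate lost-[v,a])

  windowSymDiff : List A → ℕ → ℕ → ℕ
  windowSymDiff T d i = symDiffCount (window T d i) (window T d (suc i))

  SValue-windowSymDiff : (T : List A) (d : ℕ) →
                         SValue T (suc d) (sum (map (windowSymDiff T (suc d)) (upTo (length T ∸ suc d))))
  SValue-windowSymDiff T d = windowSymDiff T (suc d) , hasCard , refl
    where
    hasCard : ∀ i → i < length T ∸ suc d →
              HasCard (SymDiffMAW (window T (suc d) i) (window T (suc d) (suc i))) (windowSymDiff T (suc d) i)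
    hasCard i i< with a , V , b , X≡ , Y≡ , _ ← window-slide T d i i< =
      subst₂ (λ X Y → HasCard (SymDiffMAW X Y) (symDiffCount X Y)) (sym X≡) (sym Y≡) (symDiffCount-HasCard a V b)

  windowSymDiff-distinct : (T : List A) (d i : ℕ) → i < length T ∸ suc d →
                           Unique (take (suc (suc d)) (drop i T)) → suc d ≤ windowSymDiff T (suc d) i
  windowSymDiff-distinct T d i i< window! with a , V , b , X≡ , Y≡ , XY≡ , V≡d ← window-slide T d i i< =
    subst₂ (λ X Y → suc d ≤ symDiffCount X Y) (sym X≡) (sym Y≡)
      (subst (λ k → suc k ≤ symDiffCount (a ∷ V) (V ∷ʳ b)) V≡d
        (symDiffCount-distinct a V b (subst Unique XY≡ window!)))

  upperBound : (T : List A) (d : ℕ) → ∃ λ s → SValue T (suc d) s × s ≤ 12 * (suc d * (length T ∸ suc d))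
  upperBound T d = _ , SValue-windowSymDiff T d , (begin
      sum (map (windowSymDiff T (suc d)) (upTo m))   ≤⟨ sum-map≤length* _ (upTo m) (λ {i} _ → step≤ i) ⟩
      length (upTo m) * (6 * suc (suc d))            ≡⟨ cong (_* (6 * suc (suc d))) (length-upTo m) ⟩
      m * (6 * suc (suc d))                          ≤⟨ *-monoʳ-≤ m (6*[1+n]≤12*n (s≤s z≤n)) ⟩
      m * (12 * suc d)                               ≡⟨ trans (*-comm m (12 * suc d)) (*-assoc 12 (suc d) m) ⟩
      12 * (suc d * m)                               ∎)
    where
    open ≤-Reasoning
    m = length T ∸ suc d
    step≤ : ∀ i → windowSymDiff T (suc d) i ≤ 6 * suc (suc d)
    step≤ i = symDiffCount≤ (window T (suc d) i) (window T (suc d) (suc i))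
                            (length-window T (suc d) i) (length-window T (suc d) (suc i))

  lowerBound : (x : A) (S : List A) (n : ℕ) → Unique (x ∷ S) → 1 ≤ length S →
               ∃ λ s → SValue (periodic x S n) (length S) s × length S * (n ∸ length S) ≤ s
  lowerBound x (y ∷ S) n xyS! _ = _ , SValue-windowSymDiff T (length S) , (begin
      suc d * (n ∸ suc d)       ≡⟨ *-comm (suc d) (n ∸ suc d) ⟩
      (n ∸ suc d) * suc d       ≡⟨ cong (λ k → (k ∸ suc d) * suc d) (sym (length-periodic x (y ∷ S) n)) ⟩
      m * suc d                 ≡⟨ cong (_* suc d) (sym (length-upTo m)) ⟩
      length (upTo m) * suc d   ≤⟨ length*≤sum-map _ (upTo m) (λ i∈ → step≥ (∈-upTo⁻ i∈)) ⟩
      sum (map (windowSymDiff T (suc d)) (upTo m)) ∎)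
    where
    open ≤-Reasoning
    T = periodic x (y ∷ S) n
    d = length S
    m = length T ∸ suc d
    step≥ : ∀ {i} → i < m → suc d ≤ windowSymDiff T (suc d) i
    step≥ {i} i< = windowSymDiff-distinct T d i i< (Unique-window-periodic i x (y ∷ S) n xyS!
      (subst (λ k → suc d < k ∸ i) (length-periodic x (y ∷ S) n) (<∸-comm i<)))

lemma16 : (Σ ℕ λ c → ∀ (σ d : ℕ) → 2 ≤ σ → 1 ≤ d → (T : List (Fin σ)) → d < length T →
    ∃ λ s → SValue T d s × s ≤ c * (d * (length T ∸ d)))
    × (Σ ℕ λ c → 1 ≤ c × (∀ (σ d n : ℕ) → 2 ≤ σ → 1 ≤ d → d + 1 ≤ σ → d < n →
    Σ (List (Fin σ)) λ T′ → length T′ ≡ n ×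
    (∃ λ s → SValue T′ d s × d * (n ∸ d) ≤ c * s)))
lemma16 = (12 , upper) , (1 , ≤-refl , lower)
  where
  upper : ∀ (σ d : ℕ) → 2 ≤ σ → 1 ≤ d → (T : List (Fin σ)) → d < length T →
          ∃ λ s → SValue T d s × s ≤ 12 * (d * (length T ∸ d))
  upper σ (suc d) _ _ T _ = upperBound Fin._≟_ T d
  lower : ∀ (σ d n : ℕ) → 2 ≤ σ → 1 ≤ d → d + 1 ≤ σ → d < n →
          Σ (List (Fin σ)) λ T′ → length T′ ≡ n × (∃ λ s → SValue T′ d s × d * (n ∸ d) ≤ 1 * s)
  lower (suc σ) d n _ 1≤d d+1≤σ _ = periodic Fin.zero S n , length-periodic Fin.zero S n ,
    subst (λ k → ∃ λ s → SValue (periodic Fin.zero S n) k s × k * (n ∸ k) ≤ 1 * s) S≡d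
      (map₂ (λ {s} → map₂ (subst (_ ≤_) (sym (*-identityˡ s))))
        (lowerBound Fin._≟_ Fin.zero S n 0S! (subst (1 ≤_) (sym S≡d) 1≤d)))
    where
    S : List (Fin (suc σ))
    S = take d (tabulate Fin.suc)
    0S! : Unique (Fin.zero ∷ S)
    0S! = Unique.take⁺ (suc d) (Unique.allFin⁺ (suc σ))
    S≡d : length S ≡ d
    S≡d = trans (length-take d (tabulate Fin.suc))
                (trans (cong (d ⊓_) (length-tabulate Fin.suc)) (m≤n⇒m⊓n≡m d≤σ))
      where d≤σ = ≤-pred (subst (_≤ suc σ) (+-comm d 1) d+1≤σ)
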